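{- Consider the smart-contract loss model with deterministic degrees $X_+=d_+$ and $X_-=d_-$ described in the context. Then $$E^+(\zeta(0))=P^+(A)=p\left(\frac{1-(d_+p)^R}{1-d_+p}\right)\left(\frac{1-d_+}{1-d_+^R}\right).$$
   Context: Model. Fix an integer $R\ge1$ and positive integers $d_+,d_-$. The graph: a rooted tree of smart contracts $V_+$ with root $0$ in which the root and every vertex at distance less than $R$ from the root has exactly $d_+$ children (so $d_+^r$ contracts at distance $r$, $0\le r\le R$); each $x\in V_+$ has exactly $d_-$ attached leaf vertices (users of $x$), $V_-(x)$ denotes $x$ with its users, and $V_-$ is the set of all users. Each contract–contract edge is open independently with probability $p\in(0,1)$ and each contract–user edge with probability $q\in(0,1)$. Given an origin $\mathcal O$, $\zeta(y)=1$ if $y$ is joined to $\mathcal O$ by a path of open edges, else $0$; $A=\{\zeta(0)=1\}$ is the event that the root is compromised. $P^+,E^+$ refer to $\mathcal O$ chosen uniformly at random from $V_+\setminus\{0\}$.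
   Formalization: The edge probabilities p and q range only over the rationals in (0,1). -}

module Defs where

open import Data.Bool using (Bool; true; false; _∧_; _∨_; if_then_else_)
open import Data.Nat as ℕ using (ℕ; zero; suc)
open import Data.Nat.Properties as ℕP using ()
open import Data.Integer using (+_)
open import Data.List using (List; []; _∷_; map; concatMap; upTo; length; foldr; zipWith)
open import Data.List.Properties using (≡-dec)
open import Data.Bool.ListAction using (any)
open import Data.Product using (_×_; _,_)
open import Data.Rational using (ℚ; 0ℚ; 1ℚ; _+_; _*_; _-_; _÷_; _/_)
open import Relation.Nullary.Decidable using (⌊_⌋; yes; no)
open import Relation.Binary.PropositionalEquality using (_≡_; refl; cong; cong₂)

-- A contract is identified by its address: the list of child indices
-- (each < d₊) read from the contract back up to the root; the root is [].  A user is given by the contract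
-- it is attached to and an index < d₋.

Address : Set
Address = List ℕ

data Vertex : Set where
  contract : Address → Vertex
  user     : Address → ℕ → Vertex

root : Vertex
root = contract []

_≟V_ : (u v : Vertex) → Bool
contract a ≟V contract b = ⌊ ≡-dec ℕP._≟_ a b ⌋
contract _ ≟V user _ _   = false
user _ _   ≟V contract _ = false
user a i   ≟V user b j   = ⌊ ≡-dec ℕP._≟_ a b ⌋ ∧ ⌊ i ℕP.≟ j ⌋

addrsAt : (d₊ r : ℕ) → List Address
addrsAt d₊ zero    = [] ∷ []
addrsAt d₊ (suc r) = concatMap (λ a → map (λ i → i ∷ a) (upTo d₊)) (addrsAt d₊ r)

addrsUpTo : (d₊ k : ℕ) → List Address
addrsUpTo d₊ zero    = []
addrsUpTo d₊ (suc k) = addrsUpTo d₊ k Data.List.++ addrsAt d₊ (suc k)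

nonRootContracts : (d₊ R : ℕ) → List Vertex
nonRootContracts d₊ R = map contract (addrsUpTo d₊ R)

contracts : (d₊ R : ℕ) → List Vertex
contracts d₊ R = root ∷ nonRootContracts d₊ R

usersOf : (d₋ : ℕ) → Address → List Vertex
usersOf d₋ a = map (user a) (upTo d₋)

vertices : (d₊ d₋ R : ℕ) → List Vertex
vertices d₊ d₋ R = contracts d₊ R Data.List.++ concatMap (usersOf d₋) ([] ∷ addrsUpTo d₊ R)

data Kind : Set where
  cc cu : Kind

record Edge : Set where
  constructor edge
  field
    kind : Kind
    end₁ : Vertex
    end₂ : Vertex

parentEdge : Address → List Edge
parentEdge []      = []
parentEdge (i ∷ a) = edge cc (contract a) (contract (i ∷ a)) ∷ []

userEdges : (d₋ : ℕ) → Address → List Edge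
userEdges d₋ a = map (λ i → edge cu (contract a) (user a i)) (upTo d₋)

edges : (d₊ d₋ R : ℕ) → List Edge
edges d₊ d₋ R =
  concatMap parentEdge (addrsUpTo d₊ R)
  Data.List.++ concatMap (userEdges d₋) ([] ∷ addrsUpTo d₊ R)

-- Bond configurations: one Bool (open = true) per edge, in the order of
-- `edges`.  All configurations of m edges:

configs : ℕ → List (List Bool)
configs zero    = [] ∷ []
configs (suc m) = concatMap (λ c → (true ∷ c) ∷ (false ∷ c) ∷ []) (configs m)

edgeProb : (p q : ℚ) → Edge → Bool → ℚ
edgeProb p q (edge cc _ _) true  = p
edgeProb p q (edge cc _ _) false = 1ℚ - p
edgeProb p q (edge cu _ _) true  = q
edgeProb p q (edge cu _ _) false = 1ℚ - q

prodℚ : List ℚ → ℚ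
prodℚ = foldr _*_ 1ℚ

sumℚ : List ℚ → ℚ
sumℚ = foldr _+_ 0ℚ

weight : (p q : ℚ) → List Edge → List Bool → ℚ
weight p q es ω = prodℚ (zipWith (edgeProb p q) es ω)

openEdges : List Edge → List Bool → List Edge
openEdges []       _          = []
openEdges (_ ∷ es) []         = []
openEdges (e ∷ es) (true ∷ ω)  = e ∷ openEdges es ω
openEdges (_ ∷ es) (false ∷ ω) = openEdges es ω

joined : ℕ → List Edge → Vertex → Vertex → Bool
joined zero    E o v = o ≟V v
joined (suc n) E o v =
  (o ≟V v) ∨ any (λ e → step e) E
  where
    step : Edge → Bool
    step (edge _ x y) = ((y ≟V v) ∧ joined n E o x) ∨ ((x ≟V v) ∧ joined n E o y)

-- ζ(y) for origin 𝒪 and configuration ω; a path in the graph has at most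
-- |V| − 1 edges, so fuel |V| decides "joined by a path of open edges".
ζ : (d₊ d₋ R : ℕ) → (𝒪 : Vertex) → List Bool → Vertex → Bool
ζ d₊ d₋ R 𝒪 ω y = joined (length (vertices d₊ d₋ R)) (openEdges (edges d₊ d₋ R) ω) 𝒪 y

boolℚ : Bool → ℚ
boolℚ true  = 1ℚ
boolℚ false = 0ℚ

Exp𝒪 : (d₊ d₋ R : ℕ) (p q : ℚ) → (List Bool → ℚ) → ℚ
Exp𝒪 d₊ d₋ R p q X =
  sumℚ (map (λ ω → weight p q (edges d₊ d₋ R) ω * X ω) (configs (length (edges d₊ d₋ R))))

Prob𝒪 : (d₊ d₋ R : ℕ) (p q : ℚ) → (List Bool → Bool) → ℚ
Prob𝒪 d₊ d₋ R p q ev = Exp𝒪 d₊ d₋ R p q (λ ω → boolℚ (ev ω))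

average : List ℚ → ℚ
average xs with length xs
... | zero  = 0ℚ
... | suc k = sumℚ xs * (+ 1 / suc k)

E⁺ : (d₊ d₋ R : ℕ) (p q : ℚ) → (Vertex → List Bool → ℚ) → ℚ
E⁺ d₊ d₋ R p q X = average (map (λ 𝒪 → Exp𝒪 d₊ d₋ R p q (X 𝒪)) (nonRootContracts d₊ R))

P⁺ : (d₊ d₋ R : ℕ) (p q : ℚ) → (Vertex → List Bool → Bool) → ℚ
P⁺ d₊ d₋ R p q ev = E⁺ d₊ d₋ R p q (λ 𝒪 ω → boolℚ (ev 𝒪 ω))

A : (d₊ d₋ R : ℕ) → Vertex → List Bool → Bool
A d₊ d₋ R 𝒪 ω = ζ d₊ d₋ R 𝒪 ω root

ℕtoℚ : ℕ → ℚ
ℕtoℚ n = + n / 1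

_^ℚ_ : ℚ → ℕ → ℚ
x ^ℚ zero  = 1ℚ
x ^ℚ suc n = x * (x ^ℚ n)

module Submission where

-- From an origin contract at depth r, the root is compromised exactly when the r contract–contract
-- edges on its path to the root are all open: a walk from the origin to the root has to leave the
-- subtree below each path edge through that very edge, and conversely the path is such a walk.
-- These r edges occur once each among the independently open edges, so the probability is p^r.
-- There are d₊^r origins at depth r, so summing gives the geometric sum Σ_{r=1}^R (d₊ p)^r, while
-- the number of origins is Σ_{r=1}^R d₊^r; the quotient of the two closed forms is the formula.

open import Defs
open import Data.Nat using (ℕ; _≥_)
open import Data.Product using (_×_)
open import Data.Rational using (ℚ; 0ℚ; 1ℚ; _<_; _*_; _-_; _÷_; ≢-nonZero)
open import Relation.Binary.PropositionalEquality using (_≡_; _≢_)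

open import Data.Bool using (Bool; true; false; T; not; _∧_; _∨_; if_then_else_)
open import Data.Bool.Properties using (T-∧; T-∨)
open import Data.Empty using (⊥; ⊥-elim)
import Data.Integer as ℤ
import Data.Integer.Solver as ℤSolver
open import Data.List using (List; []; _∷_; map; length; concatMap; _++_; upTo; replicate)
open import Data.List.Properties
  using ( map-cong; map-cong-local; map-∘; ≡-dec; ∷-injectiveˡ; ∷-injectiveʳ
        ; length-upTo; length-map; length-++; length-++-≤ˡ)
import Data.List.Membership.DecPropositional as DecMembership
open import Data.List.Membership.Propositional using (_∈_; find; lose)
open import Data.List.Membership.Propositional.Properties
  using (∈-map⁺; ∈-map⁻; ∈-++⁺ˡ; ∈-++⁺ʳ; ∈-++⁻; ∈-concatMap⁺; ∈-concatMap⁻; ∈-upTo⁺)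
open import Data.List.Relation.Binary.Pointwise using (Pointwise-≡⇒≡; ≡⇒Pointwise-≡)
open import Data.List.Relation.Binary.Suffix.Heterogeneous using (Suffix; here; there)
open import Data.List.Relation.Binary.Suffix.Heterogeneous.Properties using (length-mono)
open import Data.List.Relation.Unary.All as All using ([]; _∷_)
import Data.List.Relation.Unary.All.Properties as All
import Data.List.Relation.Unary.AllPairs as AllPairs
import Data.List.Relation.Unary.AllPairs.Properties as AllPairs
open import Data.List.Relation.Unary.Any using (here; there)
open import Data.List.Relation.Unary.Any.Properties using (any⁺; any⁻)
open import Data.List.Relation.Unary.Unique.Propositional using (Unique; []; _∷_)
import Data.List.Relation.Unary.Unique.Propositional.Properties as Unique
open import Data.Nat as ℕ using (zero; suc; _≤_; z≤n; s≤s)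
import Data.Nat.Properties as ℕ
open import Data.Product using (_,_; proj₁; proj₂; ∃-syntax)
open import Data.Rational using (_+_; _/_; 1/_; NonZero; toℚᵘ)
open import Data.Rational.Properties
import Data.Rational.Solver as ℚSolver
import Data.Rational.Unnormalised as ℚᵘ
import Data.Rational.Unnormalised.Properties as ℚᵘ
open import Data.Sum using (_⊎_; inj₁; inj₂)
open import Function using (_∘_; const; id)
open import Function.Bundles using (Equivalence; _⇔_; mk⇔)
open import Relation.Binary.Definitions using (DecidableEquality)
open import Relation.Binary.PropositionalEquality using (refl; sym; trans; cong; cong₂; subst; module ≡-Reasoning)
open import Relation.Nullary using (Dec; does; yes; no; ¬_)
open import Relation.Nullary.Decidable using (⌊_⌋; dec-true; dec-false; toWitness; fromWitness; T?; _×-dec_)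
import Relation.Nullary.Decidable as Dec

toℚᵘ-ℕtoℚ : ∀ n → toℚᵘ (ℕtoℚ n) ℚᵘ.≃ ℚᵘ.mkℚᵘ (ℤ.+ n) 0
toℚᵘ-ℕtoℚ n = toℚᵘ-fromℚᵘ (ℚᵘ.mkℚᵘ (ℤ.+ n) 0)

ℕtoℚ-suc : ∀ n → ℕtoℚ (suc n) ≡ 1ℚ + ℕtoℚ n
ℕtoℚ-suc n = toℚᵘ-injective (begin
  toℚᵘ (ℕtoℚ (suc n))               ≈⟨ toℚᵘ-ℕtoℚ (suc n) ⟩
  ℚᵘ.mkℚᵘ (ℤ.+ suc n) 0             ≈⟨ ℚᵘ.*≡* (solve 1 (λ n → (con (ℤ.+ 1) :+ n) :* con (ℤ.+ 1)
                                          := (con (ℤ.+ 1) :* con (ℤ.+ 1) :+ n :* con (ℤ.+ 1)) :* con (ℤ.+ 1))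
                                          refl (ℤ.+ n)) ⟩
  ℚᵘ.1ℚᵘ ℚᵘ.+ ℚᵘ.mkℚᵘ (ℤ.+ n) 0     ≈⟨ ℚᵘ.+-congʳ ℚᵘ.1ℚᵘ (toℚᵘ-ℕtoℚ n) ⟨
  toℚᵘ 1ℚ ℚᵘ.+ toℚᵘ (ℕtoℚ n)        ≈⟨ toℚᵘ-homo-+ 1ℚ (ℕtoℚ n) ⟨
  toℚᵘ (1ℚ + ℕtoℚ n)                ∎)
  where
  open ℚᵘ.≃-Reasoning
  open ℤSolver.+-*-Solver

-- `ℚᵘ.1/ mkℚᵘ (+ suc k) 0` is `mkℚᵘ (+ 1) k` by definition.
ℕtoℚ-inverseˡ : ∀ k → (ℤ.+ 1 / suc k) * ℕtoℚ (suc k) ≡ 1ℚ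
ℕtoℚ-inverseˡ k = toℚᵘ-injective (begin
  toℚᵘ ((ℤ.+ 1 / suc k) * ℕtoℚ (suc k))                     ≈⟨ toℚᵘ-homo-* (ℤ.+ 1 / suc k) (ℕtoℚ (suc k)) ⟩
  toℚᵘ (ℤ.+ 1 / suc k) ℚᵘ.* toℚᵘ (ℕtoℚ (suc k))             ≈⟨ ℚᵘ.*-cong (toℚᵘ-fromℚᵘ (ℚᵘ.mkℚᵘ (ℤ.+ 1) k))
                                                                          (toℚᵘ-ℕtoℚ (suc k)) ⟩
  ℚᵘ.1/ ℚᵘ.mkℚᵘ (ℤ.+ suc k) 0 ℚᵘ.* ℚᵘ.mkℚᵘ (ℤ.+ suc k) 0   ≈⟨ ℚᵘ.*-inverseˡ (ℚᵘ.mkℚᵘ (ℤ.+ suc k) 0) ⟩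
  ℚᵘ.1ℚᵘ                                                     ∎)
  where open ℚᵘ.≃-Reasoning

1^ℚn≡1 : ∀ n → 1ℚ ^ℚ n ≡ 1ℚ
1^ℚn≡1 zero    = refl
1^ℚn≡1 (suc n) = trans (*-identityˡ (1ℚ ^ℚ n)) (1^ℚn≡1 n)

p+[1-p]≡1 : ∀ p → p + (1ℚ - p) ≡ 1ℚ
p+[1-p]≡1 = solve 1 (λ p → p :+ (con 1ℚ :- p) := con 1ℚ) refl
  where open ℚSolver.+-*-Solver

powSum : ℚ → ℕ → ℚ
powSum x zero    = 0ℚ
powSum x (suc R) = powSum x R + x ^ℚ suc R

powSum-geometric : ∀ x R → powSum x R * (1ℚ - x) ≡ x * (1ℚ - x ^ℚ R)
powSum-geometric x zero    = solve 1 (λ x → con 0ℚ :* (con 1ℚ :- x) := x :* (con 1ℚ :- con 1ℚ)) refl x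
  where open ℚSolver.+-*-Solver
powSum-geometric x (suc R) = begin
  (powSum x R + x * x ^ℚ R) * (1ℚ - x)             ≡⟨ *-distribʳ-+ (1ℚ - x) (powSum x R) (x * x ^ℚ R) ⟩
  powSum x R * (1ℚ - x) + x * x ^ℚ R * (1ℚ - x)    ≡⟨ cong (_+ x * x ^ℚ R * (1ℚ - x)) (powSum-geometric x R) ⟩
  x * (1ℚ - x ^ℚ R) + x * x ^ℚ R * (1ℚ - x)        ≡⟨ solve 2 (λ x y → x :* (con 1ℚ :- y) :+ x :* y :* (con 1ℚ :- x)
                                                                  := x :* (con 1ℚ :- x :* y)) refl x (x ^ℚ R) ⟩
  x * (1ℚ - x * x ^ℚ R)                            ∎
  where
  open ℚSolver.+-*-Solver
  open ≡-Reasoning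

cancel-common-factor : ∀ (x y S N X Y Z W u : ℚ) .{{_ : NonZero Y}} .{{_ : NonZero W}} →
  S * Y ≡ x * y * X → N * Z ≡ x * W → u * N ≡ 1ℚ → S * u ≡ y * (X ÷ Y) * (Z ÷ W)
cancel-common-factor x y S N X Y Z W u SY NZ uN = begin
  S * u                              ≡⟨ cong (_* u) (sym rhs*N) ⟩
  rhs * N * u                        ≡⟨ *-assoc rhs N u ⟩
  rhs * (N * u)                      ≡⟨ cong (rhs *_) (trans (*-comm N u) uN) ⟩
  rhs * 1ℚ                           ≡⟨ *-identityʳ rhs ⟩
  rhs                                ∎
  where
  open ℚSolver.+-*-Solver
  open ≡-Reasoning
  iY = 1/ Y
  iW = 1/ W
  rhs = y * (X * iY) * (Z * iW)
  rhs*N : rhs * N ≡ S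
  rhs*N = begin
    rhs * N                          ≡⟨ solve 6 (λ y X iY Z iW N → y :* (X :* iY) :* (Z :* iW) :* N
                                                  := y :* X :* iY :* iW :* (N :* Z)) refl y X iY Z iW N ⟩
    y * X * iY * iW * (N * Z)        ≡⟨ cong (y * X * iY * iW *_) NZ ⟩
    y * X * iY * iW * (x * W)        ≡⟨ solve 6 (λ y X iY iW x W → y :* X :* iY :* iW :* (x :* W)
                                                  := x :* y :* X :* iY :* (W :* iW)) refl y X iY iW x W ⟩
    x * y * X * iY * (W * iW)        ≡⟨ cong (x * y * X * iY *_) (*-inverseʳ W) ⟩
    x * y * X * iY * 1ℚ              ≡⟨ cong (λ t → t * iY * 1ℚ) (sym SY) ⟩
    S * Y * iY * 1ℚ                  ≡⟨ solve 3 (λ S Y iY → S :* Y :* iY :* con 1ℚ := S :* (Y :* iY)) refl S Y iY ⟩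
    S * (Y * iY)                     ≡⟨ cong (S *_) (*-inverseʳ Y) ⟩
    S * 1ℚ                           ≡⟨ *-identityʳ S ⟩
    S                                ∎

private variable X Y : Set

sumℚ-++ : ∀ (f : X → ℚ) xs ys → sumℚ (map f (xs ++ ys)) ≡ sumℚ (map f xs) + sumℚ (map f ys)
sumℚ-++ f []       ys = sym (+-identityˡ _)
sumℚ-++ f (x ∷ xs) ys = trans (cong (f x +_) (sumℚ-++ f xs ys)) (sym (+-assoc (f x) _ _))

sumℚ-concatMap : ∀ (f : Y → ℚ) (g : X → List Y) xs →
                 sumℚ (map f (concatMap g xs)) ≡ sumℚ (map (λ x → sumℚ (map f (g x))) xs)
sumℚ-concatMap f g []       = refl
sumℚ-concatMap f g (x ∷ xs) =
  trans (sumℚ-++ f (g x) (concatMap g xs)) (cong (sumℚ (map f (g x)) +_) (sumℚ-concatMap f g xs))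

sumℚ-map-+ : ∀ (f g : X → ℚ) xs → sumℚ (map (λ x → f x + g x) xs) ≡ sumℚ (map f xs) + sumℚ (map g xs)
sumℚ-map-+ f g []       = refl
sumℚ-map-+ f g (x ∷ xs) = trans (cong (f x + g x +_) (sumℚ-map-+ f g xs))
  (solve 4 (λ a b c d → (a :+ b) :+ (c :+ d) := (a :+ c) :+ (b :+ d)) refl (f x) (g x) _ _)
  where open ℚSolver.+-*-Solver

sumℚ-map-*ˡ : ∀ c (f : X → ℚ) xs → sumℚ (map (λ x → c * f x) xs) ≡ c * sumℚ (map f xs)
sumℚ-map-*ˡ c f []       = sym (*-zeroʳ c)
sumℚ-map-*ˡ c f (x ∷ xs) = trans (cong (c * f x +_) (sumℚ-map-*ˡ c f xs)) (sym (*-distribˡ-+ c (f x) _))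

sumℚ-const : ∀ c (xs : List X) → sumℚ (map (const c) xs) ≡ ℕtoℚ (length xs) * c
sumℚ-const c []       = sym (*-zeroˡ c)
sumℚ-const c (x ∷ xs) = begin
  c + sumℚ (map (const c) xs)         ≡⟨ cong (c +_) (sumℚ-const c xs) ⟩
  c + ℕtoℚ (length xs) * c            ≡⟨ cong (_+ ℕtoℚ (length xs) * c) (*-identityˡ c) ⟨
  1ℚ * c + ℕtoℚ (length xs) * c       ≡⟨ *-distribʳ-+ c 1ℚ (ℕtoℚ (length xs)) ⟨
  (1ℚ + ℕtoℚ (length xs)) * c         ≡⟨ cong (_* c) (ℕtoℚ-suc (length xs)) ⟨
  ℕtoℚ (suc (length xs)) * c          ∎
  where open ≡-Reasoning

average-inverse : ∀ xs → 1 ≤ length xs → ∃[ u ] (average xs ≡ sumℚ xs * u × u * ℕtoℚ (length xs) ≡ 1ℚ)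
average-inverse xs _ with length xs
... | suc k = ℤ.+ 1 / suc k , refl , ℕtoℚ-inverseˡ k

does-sound : ∀ {P : Set} (P? : Dec P) → T (does P?) → P
does-sound (yes p) _ = p

does-complete : ∀ {P : Set} (P? : Dec P) → P → T (does P?)
does-complete (yes _) _ = _
does-complete (no ¬p) p = ¬p p

T-injective : ∀ {x y} → (T x → T y) → (T y → T x) → x ≡ y
T-injective {false} {false} _ _ = refl
T-injective {false} {true}  _ g = ⊥-elim (g _)
T-injective {true}  {false} f _ = ⊥-elim (f _)
T-injective {true}  {true}  _ _ = refl

T-not⁺ : ∀ {b} → ¬ T b → T (not b)
T-not⁺ {false} _  = _
T-not⁺ {true}  ¬b = ¬b _

T-not⁻ : ∀ {b} → T (not b) → ¬ T b
T-not⁻ {false} _ ()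

count : (X → Bool) → List X → ℕ
count P []       = 0
count P (x ∷ xs) = if P x then suc (count P xs) else count P xs

count-none : ∀ {P : X → Bool} xs → (∀ {x} → x ∈ xs → P x ≡ false) → count P xs ≡ 0
count-none []       _    = refl
count-none (x ∷ xs) none rewrite none (here refl) = count-none xs (none ∘ there)

count-∨ : ∀ (P Q : X → Bool) xs → (∀ x → T (P x) → T (Q x) → ⊥) →
          count (λ x → P x ∨ Q x) xs ≡ count P xs ℕ.+ count Q xs
count-∨ P Q []       _        = refl
count-∨ P Q (x ∷ xs) disjoint with P x in Px | Q x in Qx
... | true  | true  = ⊥-elim (disjoint x (subst T (sym Px) _) (subst T (sym Qx) _))
... | true  | false = cong suc (count-∨ P Q xs disjoint)
... | false | true  = trans (cong suc (count-∨ P Q xs disjoint)) (sym (ℕ.+-suc (count P xs) (count Q xs)))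
... | false | false = count-∨ P Q xs disjoint

module _ (_≟_ : DecidableEquality X) where

  open DecMembership _≟_ using (_∈?_)

  count-≟-unique : ∀ {xs y} → Unique xs → y ∈ xs → count (λ x → does (x ≟ y)) xs ≡ 1
  count-≟-unique {x ∷ xs} (x∉xs ∷ _) (here refl) rewrite dec-true (x ≟ x) refl =
    cong suc (count-none xs (λ z∈xs → dec-false (_ ≟ x) (λ z≡x → All.lookup x∉xs z∈xs (sym z≡x))))
  count-≟-unique {x ∷ xs} (x∉xs ∷ u) (there y∈xs) rewrite dec-false (x ≟ _) (All.lookup x∉xs y∈xs) =
    count-≟-unique u y∈xs

  count-∈?-unique : ∀ {xs ys} → Unique xs → Unique ys → (∀ {y} → y ∈ ys → y ∈ xs) →
                    count (λ x → does (x ∈? ys)) xs ≡ length ys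
  count-∈?-unique {xs} {[]}     _  _            _  = count-none xs (λ _ → refl)
  count-∈?-unique {xs} {y ∷ ys} ux (y∉ys ∷ uys) ys⊆xs = begin
    count (λ x → does (x ≟ y) ∨ does (x ∈? ys)) xs
      ≡⟨ count-∨ (λ x → does (x ≟ y)) (λ x → does (x ∈? ys)) xs disjoint ⟩
    count (λ x → does (x ≟ y)) xs ℕ.+ count (λ x → does (x ∈? ys)) xs
      ≡⟨ cong₂ ℕ._+_ (count-≟-unique ux (ys⊆xs (here refl))) (count-∈?-unique ux uys (ys⊆xs ∘ there)) ⟩
    suc (length ys) ∎
    where
    open ≡-Reasoning
    disjoint : ∀ x → T (does (x ≟ y)) → T (does (x ∈? ys)) → ⊥
    disjoint x x≡y x∈ys with refl ← does-sound (x ≟ y) x≡y = All.lookup y∉ys (does-sound (x ∈? ys) x∈ys) refl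

concatMap-unique : ∀ {f : X → List Y} {xs} → (∀ x → Unique (f x)) →
                   (∀ {x x′ z} → z ∈ f x → z ∈ f x′ → x ≡ x′) → Unique xs → Unique (concatMap f xs)
concatMap-unique {xs = xs} f-unique shared⇒≡ xs-unique =
  Unique.concat⁺ (All.map⁺ (All.universal f-unique xs))
                 (AllPairs.map⁺ (AllPairs.map (λ x≢x′ {_} (z∈ , z∈′) → x≢x′ (shared⇒≡ z∈ z∈′))
                                              xs-unique))

∈⇒1≤length : ∀ {x : X} {xs} → x ∈ xs → 1 ≤ length xs
∈⇒1≤length (here _)  = s≤s z≤n
∈⇒1≤length (there _) = s≤s z≤n

-- Independent bonds

openEdges-⊆ : ∀ es ω {e} → e ∈ openEdges es ω → e ∈ es
openEdges-⊆ (_ ∷ es) (true  ∷ ω) (here refl) = here refl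
openEdges-⊆ (_ ∷ es) (true  ∷ ω) (there e∈) = there (openEdges-⊆ es ω e∈)
openEdges-⊆ (_ ∷ es) (false ∷ ω) e∈         = there (openEdges-⊆ es ω e∈)

openEdges-[] : ∀ es {e} → ¬ e ∈ openEdges es []
openEdges-[] []      ()
openEdges-[] (_ ∷ _) ()

-- Marked edges beyond the end of ω count as closed, as in openEdges.
allOpen : (Edge → Bool) → List Edge → List Bool → Bool
allOpen P []       _       = true
allOpen P (e ∷ es) []      = not (P e) ∧ allOpen P es []
allOpen P (e ∷ es) (b ∷ ω) = (not (P e) ∨ b) ∧ allOpen P es ω

allOpen⇒∈openEdges : ∀ P es ω {x} → T (allOpen P es ω) → x ∈ es → T (P x) → x ∈ openEdges es ω
allOpen⇒∈openEdges P (e ∷ es) [] h (here refl) Px =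
  ⊥-elim (T-not⁻ (proj₁ (Equivalence.to T-∧ h)) Px)
allOpen⇒∈openEdges P (e ∷ es) [] h (there x∈es) Px =
  ⊥-elim (openEdges-[] es (allOpen⇒∈openEdges P es [] (proj₂ (Equivalence.to T-∧ h)) x∈es Px))
allOpen⇒∈openEdges P (e ∷ es) (true ∷ ω) h (here refl) Px = here refl
allOpen⇒∈openEdges P (e ∷ es) (false ∷ ω) h (here refl) Px with Equivalence.to T-∨ (proj₁ (Equivalence.to T-∧ h))
... | inj₁ ¬Pe = ⊥-elim (T-not⁻ ¬Pe Px)
allOpen⇒∈openEdges P (e ∷ es) (true ∷ ω) h (there x∈es) Px =
  there (allOpen⇒∈openEdges P es ω (proj₂ (Equivalence.to T-∧ h)) x∈es Px)
allOpen⇒∈openEdges P (e ∷ es) (false ∷ ω) h (there x∈es) Px =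
  allOpen⇒∈openEdges P es ω (proj₂ (Equivalence.to T-∧ h)) x∈es Px

-- Needs Unique: a marked edge listed twice could be open at one position and closed at the other.
∈openEdges⇒allOpen : ∀ P es ω → Unique es → (∀ {x} → x ∈ es → T (P x) → x ∈ openEdges es ω) →
                     T (allOpen P es ω)
∈openEdges⇒allOpen P []       ω       _              _    = _
∈openEdges⇒allOpen P (e ∷ es) []      (e∉es ∷ ues) marked⇒open =
  Equivalence.from T-∧ (T-not⁺ (openEdges-[] (e ∷ es) ∘ marked⇒open (here refl)) ,
                        ∈openEdges⇒allOpen P es [] ues λ x∈es Px →
                          ⊥-elim (openEdges-[] (e ∷ es) (marked⇒open (there x∈es) Px)))
∈openEdges⇒allOpen P (e ∷ es) (true ∷ ω)  (e∉es ∷ ues) marked⇒open =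
  Equivalence.from T-∧ (Equivalence.from (T-∨ {not (P e)}) (inj₂ _) , ∈openEdges⇒allOpen P es ω ues tail-open)
  where
  tail-open : ∀ {x} → x ∈ es → T (P x) → x ∈ openEdges es ω
  tail-open x∈es Px with marked⇒open (there x∈es) Px
  ... | here refl = ⊥-elim (All.lookup e∉es x∈es refl)
  ... | there x∈  = x∈
∈openEdges⇒allOpen P (e ∷ es) (false ∷ ω) (e∉es ∷ ues) marked⇒open =
  Equivalence.from T-∧ (Equivalence.from T-∨ (inj₁ (T-not⁺ closed)) ,
                        ∈openEdges⇒allOpen P es ω ues (λ x∈es → marked⇒open (there x∈es)))
  where
  closed : ¬ T (P e)
  closed Pe = All.lookup e∉es (openEdges-⊆ es ω (marked⇒open (here refl) Pe)) refl

module _ (p q : ℚ) where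

  expectation : List Edge → (List Bool → ℚ) → ℚ
  expectation es f = sumℚ (map (λ ω → weight p q es ω * f ω) (configs (length es)))

  expectation-cong : ∀ es {f g} → (∀ ω → f ω ≡ g ω) → expectation es f ≡ expectation es g
  expectation-cong es f≗g =
    cong sumℚ (map-cong (λ ω → cong (weight p q es ω *_) (f≗g ω)) (configs (length es)))

  expectation-0 : ∀ es → expectation es (const 0ℚ) ≡ 0ℚ
  expectation-0 es = begin
    sumℚ (map (λ ω → weight p q es ω * 0ℚ) cs) ≡⟨ cong sumℚ (map-cong (λ ω → *-zeroʳ (weight p q es ω)) cs) ⟩
    sumℚ (map (const 0ℚ) cs)                    ≡⟨ sumℚ-const 0ℚ cs ⟩
    ℕtoℚ (length cs) * 0ℚ                       ≡⟨ *-zeroʳ (ℕtoℚ (length cs)) ⟩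
    0ℚ                                          ∎
    where
    open ≡-Reasoning
    cs = configs (length es)

  expectation-∷ : ∀ e es f → expectation (e ∷ es) f ≡
                  edgeProb p q e true  * expectation es (f ∘ (true ∷_)) +
                  edgeProb p q e false * expectation es (f ∘ (false ∷_))
  expectation-∷ e es f = begin
    sumℚ (map F (concatMap (λ c → (true ∷ c) ∷ (false ∷ c) ∷ []) cs))
      ≡⟨ sumℚ-concatMap F (λ c → (true ∷ c) ∷ (false ∷ c) ∷ []) cs ⟩
    sumℚ (map (λ c → F (true ∷ c) + (F (false ∷ c) + 0ℚ)) cs)
      ≡⟨ cong sumℚ (map-cong split cs) ⟩
    sumℚ (map (λ c → pₒ * (w c * f (true ∷ c)) + p꜀ * (w c * f (false ∷ c))) cs)
      ≡⟨ sumℚ-map-+ (λ c → pₒ * (w c * f (true ∷ c))) (λ c → p꜀ * (w c * f (false ∷ c))) cs ⟩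
    sumℚ (map (λ c → pₒ * (w c * f (true ∷ c))) cs) + sumℚ (map (λ c → p꜀ * (w c * f (false ∷ c))) cs)
      ≡⟨ cong₂ _+_ (sumℚ-map-*ˡ pₒ _ cs) (sumℚ-map-*ˡ p꜀ _ cs) ⟩
    pₒ * expectation es (f ∘ (true ∷_)) + p꜀ * expectation es (f ∘ (false ∷_)) ∎
    where
    open ≡-Reasoning
    cs = configs (length es)
    w = weight p q es
    F = λ ω → weight p q (e ∷ es) ω * f ω
    pₒ = edgeProb p q e true
    p꜀ = edgeProb p q e false
    split : ∀ c → F (true ∷ c) + (F (false ∷ c) + 0ℚ) ≡
                  pₒ * (w c * f (true ∷ c)) + p꜀ * (w c * f (false ∷ c))
    split c = cong₂ _+_ (*-assoc pₒ (w c) _) (trans (+-identityʳ _) (*-assoc p꜀ (w c) _))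

  edgeProb-total : ∀ e → edgeProb p q e true + edgeProb p q e false ≡ 1ℚ
  edgeProb-total (edge cc _ _) = p+[1-p]≡1 p
  edgeProb-total (edge cu _ _) = p+[1-p]≡1 q

  edgeProb-cc : ∀ e → Edge.kind e ≡ cc → edgeProb p q e true ≡ p
  edgeProb-cc (edge cc _ _) refl = refl

  private
    expectation-allOpen-∷ : ∀ P e es {m} → P e ≡ m → expectation (e ∷ es) (boolℚ ∘ allOpen P (e ∷ es)) ≡
      edgeProb p q e true  * expectation es (λ ω → boolℚ ((not m ∨ true) ∧ allOpen P es ω)) +
      edgeProb p q e false * expectation es (λ ω → boolℚ ((not m ∨ false) ∧ allOpen P es ω))
    expectation-allOpen-∷ P e es refl = expectation-∷ e es _

  expectation-allOpen : ∀ P es → (∀ e → T (P e) → Edge.kind e ≡ cc) →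
                        expectation es (boolℚ ∘ allOpen P es) ≡ p ^ℚ count P es
  expectation-allOpen P []       _        = refl
  expectation-allOpen P (e ∷ es) marked⇒cc with P e in Pe
  ... | true = begin
    expectation (e ∷ es) (boolℚ ∘ allOpen P (e ∷ es))
      ≡⟨ expectation-allOpen-∷ P e es Pe ⟩
    pₒ * E + p꜀ * expectation es (const 0ℚ)
      ≡⟨ cong₂ (λ a b → a * E + p꜀ * b) (edgeProb-cc e (marked⇒cc e (subst T (sym Pe) _))) (expectation-0 es) ⟩
    p * E + p꜀ * 0ℚ
      ≡⟨ cong₂ (λ a b → p * a + b) (expectation-allOpen P es marked⇒cc) (*-zeroʳ p꜀) ⟩
    p * p ^ℚ count P es + 0ℚ
      ≡⟨ +-identityʳ _ ⟩
    p * p ^ℚ count P es ∎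
    where
    open ≡-Reasoning
    pₒ = edgeProb p q e true
    p꜀ = edgeProb p q e false
    E = expectation es (boolℚ ∘ allOpen P es)
  ... | false = begin
    expectation (e ∷ es) (boolℚ ∘ allOpen P (e ∷ es))     ≡⟨ expectation-allOpen-∷ P e es Pe ⟩
    pₒ * E + p꜀ * E                                        ≡⟨ *-distribʳ-+ E pₒ p꜀ ⟨
    (pₒ + p꜀) * E                                          ≡⟨ cong (_* E) (edgeProb-total e) ⟩
    1ℚ * E                                                 ≡⟨ *-identityˡ E ⟩
    E                                                      ≡⟨ expectation-allOpen P es marked⇒cc ⟩
    p ^ℚ count P es                                        ∎
    where
    open ≡-Reasoning
    pₒ = edgeProb p q e true
    p꜀ = edgeProb p q e false
    E = expectation es (boolℚ ∘ allOpen P es)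

-- Walks

≟V⇒≡ : ∀ u v → T (u ≟V v) → u ≡ v
≟V⇒≡ (contract a) (contract b) a≡b = cong contract (toWitness a≡b)
≟V⇒≡ (user a i)   (user b j)   h   with a≡b , i≡j ← Equivalence.to (T-∧ {⌊ ≡-dec ℕ._≟_ a b ⌋}) h =
  cong₂ user (toWitness a≡b) (toWitness i≡j)

≟V-refl : ∀ v → T (v ≟V v)
≟V-refl (contract a) = fromWitness refl
≟V-refl (user a i)   =
  Equivalence.from (T-∧ {⌊ ≡-dec ℕ._≟_ a a ⌋} {⌊ i ℕ.≟ i ⌋}) (fromWitness refl , fromWitness refl)

_≟ᵛ_ : DecidableEquality Vertex
u ≟ᵛ v = Dec.map′ (≟V⇒≡ u v) (λ { refl → ≟V-refl u }) (T? (u ≟V v))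

_≟ᵏ_ : DecidableEquality Kind
cc ≟ᵏ cc = yes refl
cc ≟ᵏ cu = no λ ()
cu ≟ᵏ cc = no λ ()
cu ≟ᵏ cu = yes refl

_≟ᵉ_ : DecidableEquality Edge
edge κ x y ≟ᵉ edge κ′ x′ y′ =
  Dec.map′ (λ { (refl , refl , refl) → refl }) (λ { refl → refl , refl , refl })
           (κ ≟ᵏ κ′ ×-dec x ≟ᵛ x′ ×-dec y ≟ᵛ y′)

StepInto : (Vertex → Set) → Vertex → Edge → Set
StepInto R v (edge _ x y) = (y ≡ v × R x) ⊎ (x ≡ v × R y)

StepInto-map : ∀ {R R′ v} e → (∀ {w} → R w → R′ w) → StepInto R v e → StepInto R′ v e
StepInto-map (edge _ _ _) f (inj₁ (y≡v , Rx)) = inj₁ (y≡v , f Rx)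
StepInto-map (edge _ _ _) f (inj₂ (x≡v , Ry)) = inj₂ (x≡v , f Ry)

module _ (E : List Edge) where

  joined-refl : ∀ n v → T (joined n E v v)
  joined-refl zero    v = ≟V-refl v
  joined-refl (suc n) v = Equivalence.from (T-∨ {v ≟V v}) (inj₁ (≟V-refl v))

  joined-zero⁻ : ∀ {o v} → T (joined 0 E o v) → o ≡ v
  joined-zero⁻ {o} {v} = ≟V⇒≡ o v

  joined-suc⁺ : ∀ {n o v e} → e ∈ E → StepInto (λ w → T (joined n E o w)) v e → T (joined (suc n) E o v)
  joined-suc⁺ {n} {o} {v} {edge κ x y} e∈E step =
    Equivalence.from (T-∨ {o ≟V v}) (inj₂ (any⁺ _ (lose e∈E (Equivalence.from T-∨ (stepT step)))))
    where
    stepT : StepInto (λ w → T (joined n E o w)) v (edge κ x y) →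
            T ((y ≟V v) ∧ joined n E o x) ⊎ T ((x ≟V v) ∧ joined n E o y)
    stepT (inj₁ (refl , Jx)) = inj₁ (Equivalence.from T-∧ (≟V-refl y , Jx))
    stepT (inj₂ (refl , Jy)) = inj₂ (Equivalence.from T-∧ (≟V-refl x , Jy))

  joined-suc⁻ : ∀ {n o v} → T (joined (suc n) E o v) →
                o ≡ v ⊎ ∃[ e ] (e ∈ E × StepInto (λ w → T (joined n E o w)) v e)
  joined-suc⁻ {n} {o} {v} h with Equivalence.to (T-∨ {o ≟V v}) h
  ... | inj₁ o≡v = inj₁ (≟V⇒≡ o v o≡v)
  ... | inj₂ h′ with find (any⁻ _ E h′)
  ... | edge κ x y , e∈E , step = inj₂ (edge κ x y , e∈E , stepInto (Equivalence.to T-∨ step))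
    where
    stepInto : T ((y ≟V v) ∧ joined n E o x) ⊎ T ((x ≟V v) ∧ joined n E o y) →
               StepInto (λ w → T (joined n E o w)) v (edge κ x y)
    stepInto (inj₁ h) with y≡v , Jx ← Equivalence.to T-∧ h = inj₁ (≟V⇒≡ y v y≡v , Jx)
    stepInto (inj₂ h) with x≡v , Jy ← Equivalence.to T-∧ h = inj₂ (≟V⇒≡ x v x≡v , Jy)

  joined-mono : ∀ {k n o v} → k ≤ n → T (joined k E o v) → T (joined n E o v)
  joined-mono {n = n} {v = v} z≤n h = subst (λ w → T (joined n E w v)) (sym (joined-zero⁻ h)) (joined-refl n v)
  joined-mono {suc k} {suc n} {o} {v} (s≤s k≤n) h with joined-suc⁻ {k} {o} {v} h
  ... | inj₁ refl              = joined-refl (suc n) _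
  ... | inj₂ (e , e∈E , step) =
    joined-suc⁺ {n} {o} {v} e∈E (StepInto-map {v = v} e (λ {w} → joined-mono {k} {n} {o} {w} k≤n) step)

  joined-∷ : ∀ {k κ x y v} → edge κ x y ∈ E → T (joined k E x v) → T (joined (suc k) E y v)
  joined-∷ {zero} {x = x} {y} {v} e∈E h =
    joined-suc⁺ {0} {y} {v} e∈E (inj₂ (joined-zero⁻ {x} {v} h , joined-refl 0 y))
  joined-∷ {suc k} {x = x} {y} {v} e∈E h with joined-suc⁻ {k} {x} {v} h
  ... | inj₁ refl              = joined-suc⁺ {suc k} {y} {v} e∈E (inj₂ (refl , joined-refl (suc k) y))
  ... | inj₂ (e , e′∈E , step) =
    joined-suc⁺ {suc k} {y} {v} e′∈E (StepInto-map {v = v} e (λ {w} → joined-∷ {k} {v = w} e∈E) step)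

  joined-escape : (S : Vertex → Set) (e₀ : Edge) →
                  (∀ {κ x y} → edge κ x y ∈ E → edge κ x y ≡ e₀ ⊎ (S x ⇔ S y)) →
                  ∀ n {o v} → T (joined n E o v) → S o → S v ⊎ e₀ ∈ E
  joined-escape S e₀ boundary zero    h So = inj₁ (subst S (joined-zero⁻ h) So)
  joined-escape S e₀ boundary (suc n) {o} {v} h So with joined-suc⁻ {n} {o} {v} h
  ... | inj₁ refl = inj₁ So
  ... | inj₂ (edge κ x y , e∈E , inj₁ (refl , Jx)) = cross (joined-escape S e₀ boundary n Jx So) (boundary e∈E)
    where
    cross : S x ⊎ e₀ ∈ E → edge κ x y ≡ e₀ ⊎ (S x ⇔ S y) → S y ⊎ e₀ ∈ E
    cross (inj₂ e₀∈E) _            = inj₂ e₀∈E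
    cross (inj₁ Sx)   (inj₁ refl)  = inj₂ e∈E
    cross (inj₁ Sx)   (inj₂ Sx⇔Sy) = inj₁ (Equivalence.to Sx⇔Sy Sx)
  ... | inj₂ (edge κ x y , e∈E , inj₂ (refl , Jy)) = cross (joined-escape S e₀ boundary n Jy So) (boundary e∈E)
    where
    cross : S y ⊎ e₀ ∈ E → edge κ x y ≡ e₀ ⊎ (S x ⇔ S y) → S x ⊎ e₀ ∈ E
    cross (inj₂ e₀∈E) _            = inj₂ e₀∈E
    cross (inj₁ Sy)   (inj₁ refl)  = inj₂ e∈E
    cross (inj₁ Sy)   (inj₂ Sx⇔Sy) = inj₁ (Equivalence.from Sx⇔Sy Sy)

-- The tree of contracts

treeEdge : ℕ → Address → Edge
treeEdge j c = edge cc (contract c) (contract (j ∷ c))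

address : Vertex → Address
address (contract a) = a
address (user a _)   = a

data EdgeShape : Edge → Set where
  contract-contract : ∀ j c → EdgeShape (treeEdge j c)
  contract-user     : ∀ c i → EdgeShape (edge cu (contract c) (user c i))

-- v lies in the subtree of contract t (addresses are read upwards, so t is a suffix).
Below : Address → Vertex → Set
Below t v = Suffix _≡_ t (address v)

subtree-boundary : ∀ j c {κ x y} → EdgeShape (edge κ x y) →
                   edge κ x y ≡ treeEdge j c ⊎ (Below (j ∷ c) x ⇔ Below (j ∷ c) y)
subtree-boundary j c (contract-contract i b) with ≡-dec ℕ._≟_ (i ∷ b) (j ∷ c)
... | yes refl = inj₁ refl
... | no  i∷b≢ = inj₂ (mk⇔ there λ { (here eq)     → ⊥-elim (i∷b≢ (sym (Pointwise-≡⇒≡ eq)))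
                                    ; (there below) → below })
subtree-boundary j c (contract-user b i) = inj₂ (mk⇔ id id)

addrsAt-suc⁻ : ∀ {d k a} → a ∈ addrsAt d (suc k) → ∃[ i ] ∃[ b ] (a ≡ i ∷ b × b ∈ addrsAt d k)
addrsAt-suc⁻ {d} {k} a∈
  with b , b∈ , a∈children ← find (∈-concatMap⁻ (λ b → map (_∷ b) (upTo d)) {addrsAt d k} a∈)
  with i , _ , refl ← ∈-map⁻ (_∷ b) a∈children = i , b , refl , b∈

length-∈-addrsAt : ∀ {d} k {a} → a ∈ addrsAt d k → length a ≡ k
length-∈-addrsAt zero    (here refl) = refl
length-∈-addrsAt {d} (suc k) a∈ with i , b , refl , b∈ ← addrsAt-suc⁻ {d} {k} a∈ = cong suc (length-∈-addrsAt k b∈)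

suffix-∈-addrsAt : ∀ {d} k {t a} → Suffix _≡_ t a → a ∈ addrsAt d k → t ∈ addrsAt d (length t)
suffix-∈-addrsAt {d} k (here eq) a∈ with refl ← Pointwise-≡⇒≡ eq =
  subst (λ n → _ ∈ addrsAt d n) (sym (length-∈-addrsAt k a∈)) a∈
suffix-∈-addrsAt zero    (there _) (here ())
suffix-∈-addrsAt zero    (there _) (there ())
suffix-∈-addrsAt {d} (suc k) (there below) a∈ with i , b , refl , b∈ ← addrsAt-suc⁻ {d} {k} a∈ =
  suffix-∈-addrsAt k below b∈

replicate-∈-addrsAt : ∀ {d} k → 1 ≤ d → replicate k 0 ∈ addrsAt d k
replicate-∈-addrsAt zero    _   = here refl
replicate-∈-addrsAt {d} (suc k) 1≤d =
  ∈-concatMap⁺ (λ b → map (_∷ b) (upTo d))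
               (lose (replicate-∈-addrsAt k 1≤d) (∈-map⁺ (_∷ replicate k 0) (∈-upTo⁺ 1≤d)))

∈-addrsUpTo⁻ : ∀ {d} R {a} → a ∈ addrsUpTo d R → ∃[ k ] (k ℕ.< R × a ∈ addrsAt d (suc k))
∈-addrsUpTo⁻ {d} (suc R) a∈ with ∈-++⁻ (addrsUpTo d R) a∈
... | inj₁ a∈′ with k , k<R , a∈k ← ∈-addrsUpTo⁻ R a∈′ = k , ℕ.m≤n⇒m≤1+n k<R , a∈k
... | inj₂ a∈R = R , ℕ.≤-refl , a∈R

∈-addrsUpTo⁺ : ∀ {d} R {k a} → k ℕ.< R → a ∈ addrsAt d (suc k) → a ∈ addrsUpTo d R
∈-addrsUpTo⁺ {d} (suc R) (s≤s k≤R) a∈ with ℕ.m≤n⇒m<n∨m≡n k≤R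
... | inj₁ k<R  = ∈-++⁺ˡ (∈-addrsUpTo⁺ R k<R a∈)
... | inj₂ refl = ∈-++⁺ʳ (addrsUpTo d R) a∈

length-∈-addrsUpTo : ∀ {d} R {a} → a ∈ addrsUpTo d R → 1 ≤ length a × length a ≤ R
length-∈-addrsUpTo R a∈ with k , k<R , a∈k ← ∈-addrsUpTo⁻ R a∈ rewrite length-∈-addrsAt (suc k) a∈k =
  s≤s z≤n , k<R

suffix-∈-addrsUpTo : ∀ {d} R {j c a} → Suffix _≡_ (j ∷ c) a → a ∈ addrsUpTo d R → j ∷ c ∈ addrsUpTo d R
suffix-∈-addrsUpTo R below a∈ with k , k<R , a∈k ← ∈-addrsUpTo⁻ R a∈ =
  ∈-addrsUpTo⁺ R (ℕ.<-≤-trans (length-mono below) (subst (ℕ._≤ R) (sym (length-∈-addrsAt (suc k) a∈k)) k<R))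
                 (suffix-∈-addrsAt (suc k) below a∈k)

R≤length-addrsUpTo : ∀ {d} R → 1 ≤ d → R ≤ length (addrsUpTo d R)
R≤length-addrsUpTo zero    _   = z≤n
R≤length-addrsUpTo {d} (suc R) 1≤d = begin
  suc R
    ≡⟨ ℕ.+-comm 1 R ⟩
  R ℕ.+ 1
    ≤⟨ ℕ.+-mono-≤ (R≤length-addrsUpTo R 1≤d) (∈⇒1≤length (replicate-∈-addrsAt (suc R) 1≤d)) ⟩
  length (addrsUpTo d R) ℕ.+ length (addrsAt d (suc R))
    ≡⟨ length-++ (addrsUpTo d R) ⟨
  length (addrsUpTo d (suc R)) ∎
  where open ℕ.≤-Reasoning

addrsAt-unique : ∀ d k → Unique (addrsAt d k)
addrsAt-unique d zero    = [] ∷ []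
addrsAt-unique d (suc k) =
  concatMap-unique (λ b → Unique.map⁺ ∷-injectiveˡ (Unique.upTo⁺ d)) same-tail (addrsAt-unique d k)
  where
  same-tail : ∀ {b b′ a : Address} → a ∈ map (_∷ b) (upTo d) → a ∈ map (_∷ b′) (upTo d) → b ≡ b′
  same-tail {b} {b′} a∈ a∈′ with _ , _ , refl ← ∈-map⁻ (_∷ b) a∈ | _ , _ , eq ← ∈-map⁻ (_∷ b′) a∈′ =
    ∷-injectiveʳ eq

addrsUpTo-unique : ∀ d R → Unique (addrsUpTo d R)
addrsUpTo-unique d zero    = []
addrsUpTo-unique d (suc R) = Unique.++⁺ (addrsUpTo-unique d R) (addrsAt-unique d (suc R)) disjoint
  where
  disjoint : ∀ {a} → ¬ (a ∈ addrsUpTo d R × a ∈ addrsAt d (suc R))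
  disjoint (a∈ , a∈′) = ℕ.<-irrefl (length-∈-addrsAt (suc R) a∈′) (s≤s (proj₂ (length-∈-addrsUpTo R a∈)))

∈-parentEdges⁻ : ∀ {e} as → e ∈ concatMap parentEdge as → ∃[ j ] ∃[ c ] (e ≡ treeEdge j c × j ∷ c ∈ as)
∈-parentEdges⁻ as e∈ with (j ∷ c) , jc∈ , here refl ← find (∈-concatMap⁻ parentEdge {as} e∈) =
  j , c , refl , jc∈

∈-userEdges⁻ : ∀ {d₋ e} as → e ∈ concatMap (userEdges d₋) as →
               ∃[ c ] ∃[ i ] (e ≡ edge cu (contract c) (user c i))
∈-userEdges⁻ {d₋} as e∈ with c , _ , e∈c ← find (∈-concatMap⁻ (userEdges d₋) {as} e∈)
                        with i , _ , refl ← ∈-map⁻ _ e∈c = c , i , refl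

edges-shape : ∀ {d₊ d₋} R {e} → e ∈ edges d₊ d₋ R → EdgeShape e
edges-shape {d₊} {d₋} R e∈ with ∈-++⁻ (concatMap parentEdge (addrsUpTo d₊ R)) e∈
... | inj₁ e∈cc with j , c , refl , _ ← ∈-parentEdges⁻ (addrsUpTo d₊ R) e∈cc = contract-contract j c
... | inj₂ e∈cu with c , i , refl ← ∈-userEdges⁻ {d₋} ([] ∷ addrsUpTo d₊ R) e∈cu = contract-user c i

treeEdge-∈-edges : ∀ {d₊ d₋} R {j c} → j ∷ c ∈ addrsUpTo d₊ R → treeEdge j c ∈ edges d₊ d₋ R
treeEdge-∈-edges R jc∈ = ∈-++⁺ˡ (∈-concatMap⁺ parentEdge (lose jc∈ (here refl)))

edges-unique : ∀ d₊ d₋ R → Unique (edges d₊ d₋ R)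
edges-unique d₊ d₋ R = Unique.++⁺ parents-unique users-unique kinds-differ
  where
  U = addrsUpTo d₊ R
  parents-unique : Unique (concatMap parentEdge U)
  parents-unique = concatMap-unique parentEdge-unique same-child (addrsUpTo-unique d₊ R)
    where
    parentEdge-unique : ∀ a → Unique (parentEdge a)
    parentEdge-unique []      = []
    parentEdge-unique (_ ∷ _) = [] ∷ []
    same-child : ∀ {a a′ e} → e ∈ parentEdge a → e ∈ parentEdge a′ → a ≡ a′
    same-child {_ ∷ _} {_ ∷ _} (here refl) (here eq) = cong (address ∘ Edge.end₂) eq
  users-unique : Unique (concatMap (userEdges d₋) ([] ∷ U))
  users-unique = concatMap-unique (λ a → Unique.map⁺ (λ { refl → refl }) (Unique.upTo⁺ d₋)) same-contract
                                  (All.tabulate []∉U ∷ addrsUpTo-unique d₊ R)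
    where
    same-contract : ∀ {a a′ e} → e ∈ userEdges d₋ a → e ∈ userEdges d₋ a′ → a ≡ a′
    same-contract e∈ e∈′ with _ , _ , refl ← ∈-map⁻ _ e∈ | _ , _ , eq ← ∈-map⁻ _ e∈′ =
      cong (address ∘ Edge.end₁) eq
    []∉U : ∀ {a} → a ∈ U → [] ≢ a
    []∉U a∈ refl with () ← proj₁ (length-∈-addrsUpTo R a∈)
  kinds-differ : ∀ {e} → ¬ (e ∈ concatMap parentEdge U × e ∈ concatMap (userEdges d₋) ([] ∷ U))
  kinds-differ (e∈cc , e∈cu)
    with _ , _ , refl , _ ← ∈-parentEdges⁻ U e∈cc | _ , _ , () ← ∈-userEdges⁻ ([] ∷ U) e∈cu

-- The path from an origin to the root

pathEdges : Address → List Edge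
pathEdges []      = []
pathEdges (j ∷ c) = treeEdge j c ∷ pathEdges c

∈-pathEdges⁻ : ∀ a {e} → e ∈ pathEdges a → ∃[ j ] ∃[ c ] (e ≡ treeEdge j c × Suffix _≡_ (j ∷ c) a)
∈-pathEdges⁻ (j ∷ c) (here refl) = j , c , refl , here (≡⇒Pointwise-≡ refl)
∈-pathEdges⁻ (j ∷ c) (there e∈) with j′ , c′ , eq , below ← ∈-pathEdges⁻ c e∈ = j′ , c′ , eq , there below

length-pathEdges : ∀ a → length (pathEdges a) ≡ length a
length-pathEdges []      = refl
length-pathEdges (_ ∷ c) = cong suc (length-pathEdges c)

pathEdges-unique : ∀ a → Unique (pathEdges a)
pathEdges-unique []      = []
pathEdges-unique (j ∷ c) = All.tabulate deeper ∷ pathEdges-unique c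
  where
  deeper : ∀ {e} → e ∈ pathEdges c → treeEdge j c ≢ e
  deeper e∈ eq with j′ , c′ , refl , below ← ∈-pathEdges⁻ c e∈ with refl ← cong (address ∘ Edge.end₂) eq =
    ℕ.<-irrefl refl (length-mono below)

joined-pathEdges : ∀ E a → (∀ {e} → e ∈ pathEdges a → e ∈ E) → T (joined (length a) E (contract a) root)
joined-pathEdges E []      _      = joined-refl E 0 root
joined-pathEdges E (j ∷ c) path⊆E =
  joined-∷ E {length c} {v = root} (path⊆E (here refl)) (joined-pathEdges E c (path⊆E ∘ there))

open DecMembership _≟ᵉ_ using (_∈?_)

onPath : Address → Edge → Bool
onPath a e = does (e ∈? pathEdges a)

module Origin (d₊ d₋ R : ℕ) (1≤d₊ : 1 ≤ d₊) {a : Address} (a∈U : a ∈ addrsUpTo d₊ R) where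

  private
    es = edges d₊ d₋ R

  pathEdges-⊆-edges : ∀ {e} → e ∈ pathEdges a → e ∈ es
  pathEdges-⊆-edges e∈ with j , c , refl , below ← ∈-pathEdges⁻ a e∈ =
    treeEdge-∈-edges {d₊} {d₋} R (suffix-∈-addrsUpTo R below a∈U)

  length≤fuel : length a ≤ length (vertices d₊ d₋ R)
  length≤fuel = begin
    length a                          ≤⟨ proj₂ (length-∈-addrsUpTo R a∈U) ⟩
    R                                 ≤⟨ R≤length-addrsUpTo R 1≤d₊ ⟩
    length (addrsUpTo d₊ R)           <⟨ s≤s (ℕ.≤-reflexive (sym (length-map contract (addrsUpTo d₊ R)))) ⟩
    length (contracts d₊ R)           ≤⟨ length-++-≤ˡ (contracts d₊ R) ⟩
    length (vertices d₊ d₋ R)         ∎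
    where open ℕ.≤-Reasoning

  ζ-origin : ∀ ω → ζ d₊ d₋ R (contract a) ω root ≡ allOpen (onPath a) es ω
  ζ-origin ω = T-injective reached⇒open open⇒reached
    where
    E = openEdges es ω
    n = length (vertices d₊ d₋ R)
    reached⇒open : T (joined n E (contract a) root) → T (allOpen (onPath a) es ω)
    reached⇒open h = ∈openEdges⇒allOpen (onPath a) es ω (edges-unique d₊ d₋ R) used
      where
      used : ∀ {e} → e ∈ es → T (onPath a e) → e ∈ E
      used _ on with j , c , refl , below ← ∈-pathEdges⁻ a (does-sound (_ ∈? pathEdges a) on)
                with joined-escape E (Below (j ∷ c)) (treeEdge j c)
                       (λ e∈E → subtree-boundary j c (edges-shape R (openEdges-⊆ es ω e∈E))) n h below
      ... | inj₁ (here ())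
      ... | inj₂ e∈E = e∈E
    open⇒reached : T (allOpen (onPath a) es ω) → T (joined n E (contract a) root)
    open⇒reached h = joined-mono E length≤fuel (joined-pathEdges E a (λ e∈ →
      allOpen⇒∈openEdges (onPath a) es ω h (pathEdges-⊆-edges e∈) (does-complete (_ ∈? pathEdges a) e∈)))

  expectation-ζ-origin : ∀ p q → Exp𝒪 d₊ d₋ R p q (λ ω → boolℚ (ζ d₊ d₋ R (contract a) ω root)) ≡
                                 p ^ℚ length a
  expectation-ζ-origin p q = begin
    expectation p q es (λ ω → boolℚ (ζ d₊ d₋ R (contract a) ω root))
      ≡⟨ expectation-cong p q es (cong boolℚ ∘ ζ-origin) ⟩
    expectation p q es (boolℚ ∘ allOpen (onPath a) es)
      ≡⟨ expectation-allOpen p q (onPath a) es onPath-cc ⟩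
    p ^ℚ count (onPath a) es
      ≡⟨ cong (p ^ℚ_) count-onPath ⟩
    p ^ℚ length a ∎
    where
    open ≡-Reasoning
    onPath-cc : ∀ e → T (onPath a e) → Edge.kind e ≡ cc
    onPath-cc e on with _ , _ , refl , _ ← ∈-pathEdges⁻ a (does-sound (e ∈? pathEdges a) on) = refl
    count-onPath : count (onPath a) es ≡ length a
    count-onPath = trans (count-∈?-unique _≟ᵉ_ (edges-unique d₊ d₋ R) (pathEdges-unique a) pathEdges-⊆-edges)
                         (length-pathEdges a)

-- Averaging over origins

sum-pow-addrsAt : ∀ d y k → sumℚ (map (λ a → y ^ℚ length a) (addrsAt d k)) ≡ (ℕtoℚ d * y) ^ℚ k
sum-pow-addrsAt d y zero    = +-identityʳ 1ℚ
sum-pow-addrsAt d y (suc k) = begin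
  sumℚ (map f (concatMap children (addrsAt d k)))             ≡⟨ sumℚ-concatMap f children (addrsAt d k) ⟩
  sumℚ (map (λ b → sumℚ (map f (children b))) (addrsAt d k))  ≡⟨ cong sumℚ (map-cong sum-children (addrsAt d k)) ⟩
  sumℚ (map (λ b → (ℕtoℚ d * y) * f b) (addrsAt d k))         ≡⟨ sumℚ-map-*ˡ (ℕtoℚ d * y) f (addrsAt d k) ⟩
  (ℕtoℚ d * y) * sumℚ (map f (addrsAt d k))                   ≡⟨ cong ((ℕtoℚ d * y) *_) (sum-pow-addrsAt d y k) ⟩
  (ℕtoℚ d * y) * (ℕtoℚ d * y) ^ℚ k                            ∎
  where
  open ≡-Reasoning
  f = λ (a : Address) → y ^ℚ length a
  children = λ (b : Address) → map (_∷ b) (upTo d)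
  sum-children : ∀ b → sumℚ (map f (children b)) ≡ (ℕtoℚ d * y) * f b
  sum-children b = begin
    sumℚ (map f (map (_∷ b) (upTo d)))  ≡⟨ cong sumℚ (map-∘ (upTo d)) ⟨
    sumℚ (map (const (y * f b)) (upTo d)) ≡⟨ sumℚ-const (y * f b) (upTo d) ⟩
    ℕtoℚ (length (upTo d)) * (y * f b)  ≡⟨ cong (λ n → ℕtoℚ n * (y * f b)) (length-upTo d) ⟩
    ℕtoℚ d * (y * f b)                  ≡⟨ *-assoc (ℕtoℚ d) y (f b) ⟨
    ℕtoℚ d * y * f b                    ∎

sum-pow-addrsUpTo : ∀ d y R → sumℚ (map (λ a → y ^ℚ length a) (addrsUpTo d R)) ≡ powSum (ℕtoℚ d * y) R
sum-pow-addrsUpTo d y zero    = refl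
sum-pow-addrsUpTo d y (suc R) = trans (sumℚ-++ (λ a → y ^ℚ length a) (addrsUpTo d R) (addrsAt d (suc R)))
                                      (cong₂ _+_ (sum-pow-addrsUpTo d y R) (sum-pow-addrsAt d y (suc R)))

ℕtoℚ-length-addrsUpTo : ∀ d R → ℕtoℚ (length (addrsUpTo d R)) ≡ powSum (ℕtoℚ d) R
ℕtoℚ-length-addrsUpTo d R = begin
  ℕtoℚ (length U)                         ≡⟨ *-identityʳ (ℕtoℚ (length U)) ⟨
  ℕtoℚ (length U) * 1ℚ                    ≡⟨ sumℚ-const 1ℚ U ⟨
  sumℚ (map (const 1ℚ) U)                 ≡⟨ cong sumℚ (map-cong (λ a → sym (1^ℚn≡1 (length a))) U) ⟩
  sumℚ (map (λ a → 1ℚ ^ℚ length a) U)     ≡⟨ sum-pow-addrsUpTo d 1ℚ R ⟩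
  powSum (ℕtoℚ d * 1ℚ) R                  ≡⟨ cong (λ x → powSum x R) (*-identityʳ (ℕtoℚ d)) ⟩
  powSum (ℕtoℚ d) R                       ∎
  where
  open ≡-Reasoning
  U = addrsUpTo d R

sum-expectation-ζ : ∀ d₊ d₋ R p q → 1 ≤ d₊ →
  sumℚ (map (λ 𝒪 → Exp𝒪 d₊ d₋ R p q (λ ω → boolℚ (ζ d₊ d₋ R 𝒪 ω root))) (nonRootContracts d₊ R)) ≡
  powSum (ℕtoℚ d₊ * p) R
sum-expectation-ζ d₊ d₋ R p q 1≤d₊ = begin
  sumℚ (map F (map contract U))              ≡⟨ cong sumℚ (map-∘ U) ⟨
  sumℚ (map (F ∘ contract) U)                ≡⟨ cong sumℚ (map-cong-local (All.tabulate (λ a∈U →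
                                                  Origin.expectation-ζ-origin d₊ d₋ R 1≤d₊ a∈U p q))) ⟩
  sumℚ (map (λ a → p ^ℚ length a) U)         ≡⟨ sum-pow-addrsUpTo d₊ p R ⟩
  powSum (ℕtoℚ d₊ * p) R                     ∎
  where
  open ≡-Reasoning
  U = addrsUpTo d₊ R
  F = λ 𝒪 → Exp𝒪 d₊ d₋ R p q (λ ω → boolℚ (ζ d₊ d₋ R 𝒪 ω root))

lemma8 : (R d₊ d₋ : ℕ) → R ≥ 1 → d₊ ≥ 1 → d₋ ≥ 1 →
         (p q : ℚ) → 0ℚ < p → p < 1ℚ → 0ℚ < q → q < 1ℚ →
         (h₁ : 1ℚ - ℕtoℚ d₊ * p ≢ 0ℚ) → (h₂ : 1ℚ - ℕtoℚ d₊ ^ℚ R ≢ 0ℚ) →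
         (E⁺ d₊ d₋ R p q (λ 𝒪 ω → boolℚ (ζ d₊ d₋ R 𝒪 ω root))
            ≡ P⁺ d₊ d₋ R p q (A d₊ d₋ R))
         × (P⁺ d₊ d₋ R p q (A d₊ d₋ R)
            ≡ p * (_÷_ (1ℚ - (ℕtoℚ d₊ * p) ^ℚ R) (1ℚ - ℕtoℚ d₊ * p) {{≢-nonZero h₁}})
                * (_÷_ (1ℚ - ℕtoℚ d₊) (1ℚ - ℕtoℚ d₊ ^ℚ R) {{≢-nonZero h₂}}))
lemma8 R d₊ d₋ R≥1 d₊≥1 _ p q _ _ _ _ h₁ h₂ = refl ,
  (begin
    average xs    ≡⟨ average≡ ⟩
    sumℚ xs * u   ≡⟨ cancel-common-factor d p (sumℚ xs) N _ _ _ _ u {{≢-nonZero h₁}} {{≢-nonZero h₂}}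
                       (trans (cong (_* (1ℚ - d * p)) (sum-expectation-ζ d₊ d₋ R p q d₊≥1)) (powSum-geometric (d * p) R))
                       (trans (cong (_* (1ℚ - d)) N≡powSum) (powSum-geometric d R))
                       u*N≡1 ⟩
    _             ∎)
  where
  open ≡-Reasoning
  d = ℕtoℚ d₊
  xs = map (λ 𝒪 → Exp𝒪 d₊ d₋ R p q (λ ω → boolℚ (ζ d₊ d₋ R 𝒪 ω root))) (nonRootContracts d₊ R)
  length-xs : length xs ≡ length (addrsUpTo d₊ R)
  length-xs = trans (length-map _ (nonRootContracts d₊ R)) (length-map contract (addrsUpTo d₊ R))
  N = ℕtoℚ (length xs)
  N≡powSum : N ≡ powSum d R
  N≡powSum = trans (cong ℕtoℚ length-xs) (ℕtoℚ-length-addrsUpTo d₊ R)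
  inverse = average-inverse xs (subst (1 ≤_) (sym length-xs) (ℕ.≤-trans R≥1 (R≤length-addrsUpTo R d₊≥1)))
  u = proj₁ inverse
  average≡ = proj₁ (proj₂ inverse)
  u*N≡1 = proj₂ (proj₂ inverse)
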